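{- The logic $\mathbf{QCKL}^{ - }$ is sound and complete with respect to the class $\mathcal{A}_{\mathsf{CKL}^{ - }}$ of CKL$^{ - }$-algebras; that is, a formula belongs to $\mathbf{QCKL}^{ - }$ if and only if it is valid in every CKL$^{ - }$-algebra.
   Context: Language: countable set of variables, $\top,\bot,\land,\neg,\forall$, countably many predicate symbols of each arity, two modal operators $\mathsf{E},\mathsf{C}$. $\mathbf{QCKL}^{ - }$ is the set of formulas derivable from: all classical predicate tautologies; $\Box(p\supset q)\supset(\Box p\supset\Box q)$ for $\Box\in\{\mathsf{E},\mathsf{C}\}$; $\mathsf{C}p\supset\mathsf{E}^np$ for each $n\in\omega$; modus ponens; uniform substitution; necessitation for $\mathsf{E}$ and $\mathsf{C}$; generalization; and the $\omega$-rule: from $\gamma\supset\mathsf{E}^n\phi$ for all $n\in\omega$ infer $\gamma\supset\mathsf{C}\phi$. A CKL$^{ - }$-algebra is a complete Boolean algebra $A$ with unary operators $\mathsf{E},\mathsf{C}$ each satisfying $\Box(x\land y)=\Box x\land\Box y$ and $\Box1=1$, and $\mathsf{C}x=\bigwedge_{n\in\omega}\mathsf{E}^nx$ for all $x$. A formula $\phi$ is valid in $A$ if $u_{\mathcal{J},\mathcal{A}}(\phi)=1$ for every nonempty domain $\mathcal{D}$, every $\mathcal{J}$ assigning to each $n$-ary predicate $P$ a map $P^{\mathcal{J}}\colon\mathcal{D}^n\to A$, and every assignment $\mathcal{A}$ of variables into $\mathcal{D}$, where $u$ is defined by: $P(x_1,\ldots,x_n)\mapsto P^{\mathcal{J}}(\mathcal{A}(x_1),\ldots,\mathcal{A}(x_n))$,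 $\top\mapsto1$, $\bot\mapsto0$, $\land,\neg\mapsto\land,-$, $\forall x\phi\mapsto\bigwedge_{d\in\mathcal{D}}u_{\mathcal{J},[d/x]\mathcal{A}}(\phi)$, $\mathsf{E}\phi\mapsto\mathsf{E}u(\phi)$, $\mathsf{C}\phi\mapsto\mathsf{C}u(\phi)$. -}

module Defs where

open import Level using (Level; Lift; lower; _⊔_; Setω) renaming (suc to lsuc)
open import Data.Nat using (ℕ; zero; suc; _<?_; _∸_; _+_; _≟_)
open import Data.Bool using (Bool; true; false; not) renaming (_∧_ to _∧ᵇ_)
open import Data.Vec using (Vec; lookup; map)
open import Data.Fin using (fromℕ<)
open import Relation.Nullary using (yes; no)
open import Relation.Binary.PropositionalEquality using (_≡_)
open import Algebra.Lattice.Bundles using (BooleanAlgebra)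

-- Syntax (de Bruijn indices for the countable set of variables;
-- no function symbols / constants; predicate symbol number P of arity n).

Var : Set
Var = ℕ

infixr 6 _∧'_
infix  7 ¬'_

data Formula : Set where
  atom : (n : ℕ) → (P : ℕ) → Vec Var n → Formula
  ⊤' ⊥' : Formula
  _∧'_ : Formula → Formula → Formula
  ¬'_  : Formula → Formula
  ∀'   : Formula → Formula          -- binds de Bruijn index 0
  E' C' : Formula → Formula

infixr 5 _⊃_
_⊃_ : Formula → Formula → Formula
φ ⊃ ψ = ¬' (φ ∧' ¬' ψ)

iterate : ∀ {a} {A : Set a} → (A → A) → ℕ → A → A
iterate f zero    x = x
iterate f (suc n) x = f (iterate f n x)

E'^ : ℕ → Formula → Formula
E'^ = iterate E'

p q : Formula
p = atom 0 0 Data.Vec.[]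
q = atom 0 1 Data.Vec.[]

liftR : (ℕ → ℕ) → ℕ → ℕ
liftR ρ zero    = zero
liftR ρ (suc i) = suc (ρ i)

rename : (ℕ → ℕ) → Formula → Formula
rename ρ (atom n P ys) = atom n P (map ρ ys)
rename ρ ⊤'        = ⊤'
rename ρ ⊥'        = ⊥'
rename ρ (φ ∧' ψ)  = rename ρ φ ∧' rename ρ ψ
rename ρ (¬' φ)    = ¬' rename ρ φ
rename ρ (∀' φ)    = ∀' (rename (liftR ρ) φ)
rename ρ (E' φ)    = E' (rename ρ φ)
rename ρ (C' φ)    = C' (rename ρ φ)

-- φ[y/x] for the variable bound by ∀': index 0 ↦ y, index (suc i) ↦ i
inst : Var → ℕ → ℕ
inst y zero    = y
inst y (suc i) = i

-- abstraction of the free variable x (used for ∀x φ): x ↦ 0, others shift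
abstr : Var → ℕ → ℕ
abstr x i with i ≟ x
... | yes _ = zero
... | no  _ = suc i

-- Uniform substitution of formulas for predicate symbols.
-- σ n P is the substituend for the n-ary symbol P: in it, indices 0..n-1
-- stand for the n argument places, and index n + j stands for the free
-- variable j (parameters); under k binders parameters are shifted by k.

argEnv : ∀ {n} → Vec Var n → ℕ → ℕ → ℕ
argEnv {n} ys k i with i <? n
... | yes i<n = lookup ys (fromℕ< i<n)
... | no  _   = (i ∸ n) + k

substP' : ℕ → ((n P : ℕ) → Formula) → Formula → Formula
substP' k σ (atom n P ys) = rename (argEnv ys k) (σ n P)
substP' k σ ⊤'       = ⊤'
substP' k σ ⊥'       = ⊥'
substP' k σ (φ ∧' ψ) = substP' k σ φ ∧' substP' k σ ψ
substP' k σ (¬' φ)   = ¬' substP' k σ φ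
substP' k σ (∀' φ)   = ∀' (substP' (suc k) σ φ)
substP' k σ (E' φ)   = E' (substP' k σ φ)
substP' k σ (C' φ)   = C' (substP' k σ φ)

substP : ((n P : ℕ) → Formula) → Formula → Formula
substP = substP' zero

-- Classical predicate tautologies: the theorems of a standard Hilbert
-- calculus for classical first-order logic (Mendelson style): all
-- instances of propositional tautologies, the instantiation axiom, and the
-- ∀-distribution axiom; closed under MP and Gen (which the logic has).

evalB : (Formula → Bool) → Formula → Bool
evalB v ⊤'       = true
evalB v ⊥'       = false
evalB v (φ ∧' ψ) = evalB v φ ∧ᵇ evalB v ψ
evalB v (¬' φ)   = not (evalB v φ)
evalB v φ        = v φ

PropTautology : Formula → Set
PropTautology φ = (v : Formula → Bool) → evalB v φ ≡ true

data PredAxiom : Formula → Set where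
  taut  : ∀ {φ} → PropTautology φ → PredAxiom φ
  inst∀ : ∀ φ y → PredAxiom (∀' φ ⊃ rename (inst y) φ)
  dist∀ : ∀ φ ψ → PredAxiom (∀' (rename suc φ ⊃ ψ) ⊃ (φ ⊃ ∀' ψ))

data QCKL⁻ : Formula → Set where
  ax    : ∀ {φ} → PredAxiom φ → QCKL⁻ φ
  K-E   : QCKL⁻ (E' (p ⊃ q) ⊃ (E' p ⊃ E' q))
  K-C   : QCKL⁻ (C' (p ⊃ q) ⊃ (C' p ⊃ C' q))
  C-E   : ∀ n → QCKL⁻ (C' p ⊃ E'^ n p)
  mp    : ∀ {φ ψ} → QCKL⁻ (φ ⊃ ψ) → QCKL⁻ φ → QCKL⁻ ψ
  us    : ∀ {φ} (σ : (n P : ℕ) → Formula) → QCKL⁻ φ → QCKL⁻ (substP σ φ)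
  nec-E : ∀ {φ} → QCKL⁻ φ → QCKL⁻ (E' φ)
  nec-C : ∀ {φ} → QCKL⁻ φ → QCKL⁻ (C' φ)
  gen   : ∀ {φ} (x : Var) → QCKL⁻ φ → QCKL⁻ (∀' (rename (abstr x) φ))
  ω-rule : ∀ {γ φ} → ((n : ℕ) → QCKL⁻ (γ ⊃ E'^ n φ)) → QCKL⁻ (γ ⊃ C' φ)

-- CKL⁻-algebras: complete Boolean algebras (meets of all families indexed
-- by types of level i) with operators E, C.

record CKL⁻Algebra (c ℓ i : Level) : Set (lsuc (c ⊔ ℓ ⊔ i)) where
  field
    booleanAlgebra : BooleanAlgebra c ℓ
  open BooleanAlgebra booleanAlgebra public

  _≤_ : Carrier → Carrier → Set ℓ
  x ≤ y = (x ∧ y) ≈ x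

  field
    ⋀          : {I : Set i} → (I → Carrier) → Carrier
    ⋀-lower    : {I : Set i} (f : I → Carrier) (j : I) → ⋀ f ≤ f j
    ⋀-greatest : {I : Set i} (f : I → Carrier) (x : Carrier) →
                 ((j : I) → x ≤ f j) → x ≤ ⋀ f
    E C        : Carrier → Carrier
    E-cong     : ∀ {x y} → x ≈ y → E x ≈ E y
    C-cong     : ∀ {x y} → x ≈ y → C x ≈ C y
    E-∧        : ∀ x y → E (x ∧ y) ≈ (E x ∧ E y)
    C-∧        : ∀ x y → C (x ∧ y) ≈ (C x ∧ C y)
    E-⊤        : E ⊤ ≈ ⊤
    C-⊤        : C ⊤ ≈ ⊤
    C-def      : ∀ x → C x ≈ ⋀ (λ (n : Lift i ℕ) → iterate E (lower n) x)

module _ {c ℓ i} (𝔸 : CKL⁻Algebra c ℓ i) where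
  open CKL⁻Algebra 𝔸

  extend : {D : Set i} → D → (ℕ → D) → ℕ → D
  extend d 𝒜 zero    = d
  extend d 𝒜 (suc k) = 𝒜 k

  ⟦_⟧ : {D : Set i} → Formula → (𝒥 : (n P : ℕ) → Vec D n → Carrier) →
        (𝒜 : ℕ → D) → Carrier
  ⟦ atom n P ys ⟧ 𝒥 𝒜 = 𝒥 n P (map 𝒜 ys)
  ⟦ ⊤' ⟧       𝒥 𝒜 = ⊤
  ⟦ ⊥' ⟧       𝒥 𝒜 = ⊥
  ⟦ φ ∧' ψ ⟧   𝒥 𝒜 = ⟦ φ ⟧ 𝒥 𝒜 ∧ ⟦ ψ ⟧ 𝒥 𝒜
  ⟦ ¬' φ ⟧     𝒥 𝒜 = ¬ ⟦ φ ⟧ 𝒥 𝒜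
  ⟦ ∀' φ ⟧     𝒥 𝒜 = ⋀ (λ d → ⟦ φ ⟧ 𝒥 (extend d 𝒜))
  ⟦ E' φ ⟧     𝒥 𝒜 = E (⟦ φ ⟧ 𝒥 𝒜)
  ⟦ C' φ ⟧     𝒥 𝒜 = C (⟦ φ ⟧ 𝒥 𝒜)

  -- valid in 𝔸: value 1 for every nonempty domain, interpretation, assignment
  -- (an assignment ℕ → D exists only for nonempty D)
  ValidIn : Formula → Set (lsuc i ⊔ c ⊔ ℓ)
  ValidIn φ = (D : Set i) (d₀ : D) (𝒥 : (n P : ℕ) → Vec D n → Carrier)
              (𝒜 : ℕ → D) → ⟦ φ ⟧ 𝒥 𝒜 ≈ ⊤

Valid : Formula → Setω
Valid φ = ∀ {c ℓ i} (𝔸 : CKL⁻Algebra c ℓ i) → ValidIn 𝔸 φ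

record SoundAndComplete (φ : Formula) : Setω where
  field
    soundness    : QCKL⁻ φ → Valid φ
    completeness : Valid φ → QCKL⁻ φ

-- Soundness: every axiom denotes ⊤ and every rule preserves this in any
-- CKL⁻-algebra; the ω-rule is sound because C x is the meet of the Eⁿ x.
--
-- Completeness: the Lindenbaum algebra of QCKL⁻ need not be complete, so we
-- complete it, representing an element by a set of formulas (standing for
-- its join) and comparing sets through their upper bounds. E acts on a set
-- through the E-images of the formulas below it, and C is forced to be ⋀ Eⁿ.
-- The embedding φ ↦ ↓ φ preserves the Boolean operations and E, and, thanks
-- to the ω-rule and generalization, also the infinite meets interpreting C
-- and ∀. So in the canonical model, where variables denote themselves, φ
-- denotes ↓ φ; if φ is valid this gives ⊤ ⊑ φ, hence φ is provable.

module Submission where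

open import Defs
open import Level using (Lift; lift; lower; 0ℓ) renaming (suc to lsuc; _⊔_ to _⊔ˡ_)
open import Data.Nat as ℕ using (ℕ; zero; suc; _+_; _∸_; _<_; _⊔_; _<?_)
import Data.Nat.Properties as ℕ
open import Data.Bool using (Bool; true; false; not) renaming (_∧_ to _∧ᵇ_)
open import Data.Bool.Properties using (∧-conicalˡ; ∧-conicalʳ)
open import Data.Fin using (Fin; fromℕ<) renaming (zero to fzero; suc to fsuc)
open import Data.Vec using (Vec; []; _∷_; lookup; map)
import Data.Vec.Properties as Vec
open import Data.List using (List; []; _∷_; _++_)
open import Data.List.Membership.Propositional using (_∈_; _∉_)
open import Data.List.Membership.Propositional.Properties using (∈-++⁺ˡ; ∈-++⁺ʳ)
open import Data.List.Relation.Unary.Any using (here; there)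
open import Data.Product using (Σ; _×_; _,_; proj₁; proj₂)
open import Data.Sum using (_⊎_; inj₁; inj₂)
open import Data.Empty using (⊥-elim)
open import Function using (_∘_; id)
open import Relation.Nullary using (Dec; yes; no)
open import Relation.Nullary.Decidable using (map′; _×-dec_)
open import Relation.Binary.Definitions using (DecidableEquality)
open import Relation.Binary.Bundles using (Setoid)
open import Algebra.Lattice.Bundles using (BooleanAlgebra)
import Algebra.Consequences.Setoid as Consequences
import Algebra.Lattice.Properties.BooleanAlgebra as BooleanAlgebraₚ
import Algebra.Lattice.Properties.Lattice as Latticeₚ
import Relation.Binary.Reasoning.Setoid as SetoidReasoning
open import Relation.Binary.Lattice.Bundles using () renaming (Lattice to OrderTheoreticLattice)
open import Relation.Binary.PropositionalEquality
  using (_≡_; _≢_; refl; sym; trans; cong; cong₂; subst; subst₂)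

tag : Formula → ℕ
tag (atom _ _ _) = 0
tag ⊤'           = 1
tag ⊥'           = 2
tag (_ ∧' _)     = 3
tag (¬' _)       = 4
tag (∀' _)       = 5
tag (E' _)       = 6
tag (C' _)       = 7

infix 4 _≟_
_≟_ : DecidableEquality Formula
≟-sameTag : ∀ φ ψ → tag φ ≡ tag ψ → Dec (φ ≡ ψ)

φ ≟ ψ with tag φ ℕ.≟ tag ψ
... | yes same  = ≟-sameTag φ ψ same
... | no differ = no (differ ∘ cong tag)

-- Matching tag φ ≡ tag ψ against refl disposes of all pairs of distinct
-- constructors at once.
≟-sameTag (atom n P ys) (atom m Q zs) refl with n ℕ.≟ m
... | no n≢m   = no λ { refl → n≢m refl }
... | yes refl = map′ (λ { (refl , refl) → refl }) (λ { refl → refl , refl })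
                      (P ℕ.≟ Q ×-dec Vec.≡-dec ℕ._≟_ ys zs)
≟-sameTag ⊤' ⊤' refl = yes refl
≟-sameTag ⊥' ⊥' refl = yes refl
≟-sameTag (φ ∧' ψ) (φ' ∧' ψ') refl =
  map′ (λ { (refl , refl) → refl }) (λ { refl → refl , refl }) (φ ≟ φ' ×-dec ψ ≟ ψ')
≟-sameTag (¬' φ) (¬' ψ) refl = map′ (cong ¬'_) (λ { refl → refl }) (φ ≟ ψ)
≟-sameTag (∀' φ) (∀' ψ) refl = map′ (cong ∀') (λ { refl → refl }) (φ ≟ ψ)
≟-sameTag (E' φ) (E' ψ) refl = map′ (cong E') (λ { refl → refl }) (φ ≟ ψ)
≟-sameTag (C' φ) (C' ψ) refl = map′ (cong C') (λ { refl → refl }) (φ ≟ ψ)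

fvBound-vec : ∀ {n} → Vec Var n → ℕ
fvBound-vec []       = 0
fvBound-vec (y ∷ ys) = suc y ⊔ fvBound-vec ys

fvBound : Formula → ℕ
fvBound (atom _ _ ys) = fvBound-vec ys
fvBound ⊤'            = 0
fvBound ⊥'            = 0
fvBound (φ ∧' ψ)      = fvBound φ ⊔ fvBound ψ
fvBound (¬' φ)        = fvBound φ
fvBound (∀' φ)        = ℕ.pred (fvBound φ)
fvBound (E' φ)        = fvBound φ
fvBound (C' φ)        = fvBound φ

AgreeBelow : ℕ → (ℕ → ℕ) → (ℕ → ℕ) → Set
AgreeBelow k ρ ρ' = ∀ i → i < k → ρ i ≡ ρ' i

AgreeBelow-mono : ∀ {k l ρ ρ'} → k ℕ.≤ l → AgreeBelow l ρ ρ' → AgreeBelow k ρ ρ'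
AgreeBelow-mono k≤l agree i i<k = agree i (ℕ.<-≤-trans i<k k≤l)

map-cong-below : ∀ {n} (ys : Vec Var n) {ρ ρ'} →
                 AgreeBelow (fvBound-vec ys) ρ ρ' → map ρ ys ≡ map ρ' ys
map-cong-below []       agree = refl
map-cong-below (y ∷ ys) agree =
  cong₂ _∷_ (agree y (ℕ.m≤m⊔n (suc y) (fvBound-vec ys)))
            (map-cong-below ys (AgreeBelow-mono (ℕ.m≤n⊔m (suc y) (fvBound-vec ys)) agree))

liftR-cong-below : ∀ k {ρ ρ'} → AgreeBelow (ℕ.pred k) ρ ρ' → AgreeBelow k (liftR ρ) (liftR ρ')
liftR-cong-below k agree zero    _   = refl
liftR-cong-below k agree (suc i) i<k = cong suc (agree i (ℕ.pred-mono-≤ i<k))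

rename-cong-below : ∀ φ {ρ ρ'} → AgreeBelow (fvBound φ) ρ ρ' → rename ρ φ ≡ rename ρ' φ
rename-cong-below (atom n P ys) agree = cong (atom n P) (map-cong-below ys agree)
rename-cong-below ⊤'       agree = refl
rename-cong-below ⊥'       agree = refl
rename-cong-below (φ ∧' ψ) agree =
  cong₂ _∧'_ (rename-cong-below φ (AgreeBelow-mono (ℕ.m≤m⊔n (fvBound φ) (fvBound ψ)) agree))
             (rename-cong-below ψ (AgreeBelow-mono (ℕ.m≤n⊔m (fvBound φ) (fvBound ψ)) agree))
rename-cong-below (¬' φ)   agree = cong ¬'_ (rename-cong-below φ agree)
rename-cong-below (∀' φ)   agree = cong ∀' (rename-cong-below φ (liftR-cong-below (fvBound φ) agree))
rename-cong-below (E' φ)   agree = cong E' (rename-cong-below φ agree)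
rename-cong-below (C' φ)   agree = cong C' (rename-cong-below φ agree)

rename-cong : ∀ φ {ρ ρ'} → (∀ i → ρ i ≡ ρ' i) → rename ρ φ ≡ rename ρ' φ
rename-cong φ ρ≗ρ' = rename-cong-below φ (λ i _ → ρ≗ρ' i)

liftR-∘ : ∀ ρ σ i → liftR ρ (liftR σ i) ≡ liftR (ρ ∘ σ) i
liftR-∘ ρ σ zero    = refl
liftR-∘ ρ σ (suc i) = refl

liftR-id : ∀ i → liftR id i ≡ i
liftR-id zero    = refl
liftR-id (suc i) = refl

rename-∘ : ∀ φ ρ σ → rename ρ (rename σ φ) ≡ rename (ρ ∘ σ) φ
rename-∘ (atom n P ys) ρ σ = cong (atom n P) (sym (Vec.map-∘ ρ σ ys))
rename-∘ ⊤'       ρ σ = refl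
rename-∘ ⊥'       ρ σ = refl
rename-∘ (φ ∧' ψ) ρ σ = cong₂ _∧'_ (rename-∘ φ ρ σ) (rename-∘ ψ ρ σ)
rename-∘ (¬' φ)   ρ σ = cong ¬'_ (rename-∘ φ ρ σ)
rename-∘ (∀' φ)   ρ σ =
  cong ∀' (trans (rename-∘ φ (liftR ρ) (liftR σ)) (rename-cong φ (liftR-∘ ρ σ)))
rename-∘ (E' φ)   ρ σ = cong E' (rename-∘ φ ρ σ)
rename-∘ (C' φ)   ρ σ = cong C' (rename-∘ φ ρ σ)

rename-id : ∀ φ → rename id φ ≡ φ
rename-id (atom n P ys) = cong (atom n P) (Vec.map-id ys)
rename-id ⊤'       = refl
rename-id ⊥'       = refl
rename-id (φ ∧' ψ) = cong₂ _∧'_ (rename-id φ) (rename-id ψ)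
rename-id (¬' φ)   = cong ¬'_ (rename-id φ)
rename-id (∀' φ)   = cong ∀' (trans (rename-cong φ liftR-id) (rename-id φ))
rename-id (E' φ)   = cong E' (rename-id φ)
rename-id (C' φ)   = cong C' (rename-id φ)

abstr-self : ∀ y → abstr y y ≡ zero
abstr-self y with y ℕ.≟ y
... | yes _  = refl
... | no y≢y = ⊥-elim (y≢y refl)

abstr-≢ : ∀ {i y} → i ≢ y → abstr y i ≡ suc i
abstr-≢ {i} {y} i≢y with i ℕ.≟ y
... | yes i≡y = ⊥-elim (i≢y i≡y)
... | no _    = refl

argEnv-[] : ∀ k i → argEnv [] k i ≡ i + k
argEnv-[] k i with i <? 0
... | no _ = refl

rename-argEnv-[] : ∀ φ → rename (argEnv [] 0) φ ≡ φ
rename-argEnv-[] φ =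
  trans (rename-cong φ λ i → trans (argEnv-[] 0 i) (ℕ.+-identityʳ i)) (rename-id φ)

substP'-E'^ : ∀ n k σ φ → substP' k σ (E'^ n φ) ≡ E'^ n (substP' k σ φ)
substP'-E'^ zero    k σ φ = refl
substP'-E'^ (suc n) k σ φ = cong E' (substP'-E'^ n k σ φ)

infixr 6 _‵∧_
infix  7 ‵¬_
infixr 5 _‵⇒_

data Schema (n : ℕ) : Set where
  var    : Fin n → Schema n
  ‵⊤ ‵⊥  : Schema n
  _‵∧_   : Schema n → Schema n → Schema n
  ‵¬_    : Schema n → Schema n

_‵⇒_ : ∀ {n} → Schema n → Schema n → Schema n
e ‵⇒ e' = ‵¬ (e ‵∧ ‵¬ e')

x₀ : ∀ {n} → Schema (suc n)
x₀ = var fzero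

x₁ : ∀ {n} → Schema (suc (suc n))
x₁ = var (fsuc fzero)

x₂ : ∀ {n} → Schema (suc (suc (suc n)))
x₂ = var (fsuc (fsuc fzero))

x₃ : ∀ {n} → Schema (suc (suc (suc (suc n))))
x₃ = var (fsuc (fsuc (fsuc fzero)))

instantiate : ∀ {n} → Schema n → Vec Formula n → Formula
instantiate (var i)   φs = lookup φs i
instantiate ‵⊤        φs = ⊤'
instantiate ‵⊥        φs = ⊥'
instantiate (e ‵∧ e') φs = instantiate e φs ∧' instantiate e' φs
instantiate (‵¬ e)    φs = ¬' instantiate e φs

evalSchema : ∀ {n} → Schema n → Vec Bool n → Bool
evalSchema (var i)   bs = lookup bs i
evalSchema ‵⊤        bs = true
evalSchema ‵⊥        bs = false
evalSchema (e ‵∧ e') bs = evalSchema e bs ∧ᵇ evalSchema e' bs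
evalSchema (‵¬ e)    bs = not (evalSchema e bs)

evalB-instantiate : ∀ v {n} (e : Schema n) φs →
                    evalB v (instantiate e φs) ≡ evalSchema e (map (evalB v) φs)
evalB-instantiate v (var i)   φs = sym (Vec.lookup-map i (evalB v) φs)
evalB-instantiate v ‵⊤        φs = refl
evalB-instantiate v ‵⊥        φs = refl
evalB-instantiate v (e ‵∧ e') φs = cong₂ _∧ᵇ_ (evalB-instantiate v e φs) (evalB-instantiate v e' φs)
evalB-instantiate v (‵¬ e)    φs = cong not (evalB-instantiate v e φs)

allTrue : ∀ n → (Vec Bool n → Bool) → Bool
allTrue zero    f = f []
allTrue (suc n) f = allTrue n (f ∘ (true ∷_)) ∧ᵇ allTrue n (f ∘ (false ∷_))

allTrue-sound : ∀ {n} f → allTrue n f ≡ true → ∀ bs → f bs ≡ true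
allTrue-sound f all []           = all
allTrue-sound f all (true ∷ bs)  = allTrue-sound (f ∘ (true ∷_)) (∧-conicalˡ _ _ all) bs
allTrue-sound f all (false ∷ bs) = allTrue-sound (f ∘ (false ∷_)) (∧-conicalʳ _ _ all) bs

IsTautology : ∀ {n} → Schema n → Set
IsTautology {n} e = allTrue n (evalSchema e) ≡ true

⊢-tautology : ∀ {n} (e : Schema n) → IsTautology e → ∀ φs → QCKL⁻ (instantiate e φs)
⊢-tautology e checked φs =
  ax (taut λ v → trans (evalB-instantiate v e φs) (allTrue-sound (evalSchema e) checked _))

by-tautology₁ : ∀ {n} (e₁ e₂ : Schema n) → IsTautology (e₁ ‵⇒ e₂) → ∀ φs →
                QCKL⁻ (instantiate e₁ φs) → QCKL⁻ (instantiate e₂ φs)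
by-tautology₁ e₁ e₂ checked φs = mp (⊢-tautology (e₁ ‵⇒ e₂) checked φs)

by-tautology₂ : ∀ {n} (e₁ e₂ e₃ : Schema n) → IsTautology (e₁ ‵⇒ e₂ ‵⇒ e₃) → ∀ φs →
                QCKL⁻ (instantiate e₁ φs) → QCKL⁻ (instantiate e₂ φs) → QCKL⁻ (instantiate e₃ φs)
by-tautology₂ e₁ e₂ e₃ checked φs ⊢e₁ = mp (mp (⊢-tautology (e₁ ‵⇒ e₂ ‵⇒ e₃) checked φs) ⊢e₁)

infix 4 _⊑_
_⊑_ : Formula → Formula → Set
φ ⊑ ψ = QCKL⁻ (φ ⊃ ψ)

⊢⊤ : QCKL⁻ ⊤'
⊢⊤ = ⊢-tautology ‵⊤ refl []

⊤⊑⇒⊢ : ∀ {φ} → ⊤' ⊑ φ → QCKL⁻ φ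
⊤⊑⇒⊢ ⊤⊑φ = mp ⊤⊑φ ⊢⊤

⊑-refl : ∀ φ → φ ⊑ φ
⊑-refl φ = ⊢-tautology (x₀ ‵⇒ x₀) refl (φ ∷ [])

⊑-trans : ∀ {φ ψ χ} → φ ⊑ ψ → ψ ⊑ χ → φ ⊑ χ
⊑-trans {φ} {ψ} {χ} = by-tautology₂ (x₀ ‵⇒ x₁) (x₁ ‵⇒ x₂) (x₀ ‵⇒ x₂) refl (φ ∷ ψ ∷ χ ∷ [])

⊑-⊤ : ∀ φ → φ ⊑ ⊤'
⊑-⊤ φ = ⊢-tautology (x₀ ‵⇒ ‵⊤) refl (φ ∷ [])

⊥-⊑ : ∀ φ → ⊥' ⊑ φ
⊥-⊑ φ = ⊢-tautology (‵⊥ ‵⇒ x₀) refl (φ ∷ [])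

⊑-∧ : ∀ {φ ψ χ} → χ ⊑ φ → χ ⊑ ψ → χ ⊑ φ ∧' ψ
⊑-∧ {φ} {ψ} {χ} = by-tautology₂ (x₂ ‵⇒ x₀) (x₂ ‵⇒ x₁) (x₂ ‵⇒ x₀ ‵∧ x₁) refl (φ ∷ ψ ∷ χ ∷ [])

∧-⊑ˡ : ∀ φ ψ → φ ∧' ψ ⊑ φ
∧-⊑ˡ φ ψ = ⊢-tautology (x₀ ‵∧ x₁ ‵⇒ x₀) refl (φ ∷ ψ ∷ [])

∧-⊑ʳ : ∀ φ ψ → φ ∧' ψ ⊑ ψ
∧-⊑ʳ φ ψ = ⊢-tautology (x₀ ‵∧ x₁ ‵⇒ x₁) refl (φ ∷ ψ ∷ [])

¬-antitone : ∀ {φ ψ} → φ ⊑ ψ → ¬' ψ ⊑ ¬' φ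
¬-antitone {φ} {ψ} = by-tautology₁ (x₀ ‵⇒ x₁) (‵¬ x₁ ‵⇒ ‵¬ x₀) refl (φ ∷ ψ ∷ [])

⊑¬-sym : ∀ {φ ψ} → φ ⊑ ¬' ψ → ψ ⊑ ¬' φ
⊑¬-sym {φ} {ψ} = by-tautology₁ (x₀ ‵⇒ ‵¬ x₁) (x₁ ‵⇒ ‵¬ x₀) refl (φ ∷ ψ ∷ [])

¬⊑⇒⊤⊑ : ∀ {φ} → ¬' φ ⊑ φ → ⊤' ⊑ φ
¬⊑⇒⊤⊑ {φ} = by-tautology₁ (‵¬ x₀ ‵⇒ x₀) (‵⊤ ‵⇒ x₀) refl (φ ∷ [])

⊑¬⇒⊑⊥ : ∀ {φ} → φ ⊑ ¬' φ → φ ⊑ ⊥'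
⊑¬⇒⊑⊥ {φ} = by-tautology₁ (x₀ ‵⇒ ‵¬ x₀) (x₀ ‵⇒ ‵⊥) refl (φ ∷ [])

curryˡ : ∀ {φ ψ χ} → φ ∧' ψ ⊑ χ → φ ⊑ ψ ⊃ χ
curryˡ {φ} {ψ} {χ} = by-tautology₁ (x₀ ‵∧ x₁ ‵⇒ x₂) (x₀ ‵⇒ x₁ ‵⇒ x₂) refl (φ ∷ ψ ∷ χ ∷ [])

curryʳ : ∀ {φ ψ χ} → φ ∧' ψ ⊑ χ → ψ ⊑ φ ⊃ χ
curryʳ {φ} {ψ} {χ} = by-tautology₁ (x₀ ‵∧ x₁ ‵⇒ x₂) (x₁ ‵⇒ x₀ ‵⇒ x₂) refl (φ ∷ ψ ∷ χ ∷ [])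

⊃-contract : ∀ {φ ψ} → φ ⊑ φ ⊃ ψ → φ ⊑ ψ
⊃-contract {φ} {ψ} = by-tautology₁ (x₀ ‵⇒ x₀ ‵⇒ x₁) (x₀ ‵⇒ x₁) refl (φ ∷ ψ ∷ [])

⊃-exchange : ∀ {φ ψ χ} → φ ⊑ ψ ⊃ χ → ψ ⊑ φ ⊃ χ
⊃-exchange {φ} {ψ} {χ} = by-tautology₁ (x₀ ‵⇒ x₁ ‵⇒ x₂) (x₁ ‵⇒ x₀ ‵⇒ x₂) refl (φ ∷ ψ ∷ χ ∷ [])

⊑-⊃-weaken : ∀ φ ψ → ψ ⊑ φ ⊃ ψ
⊑-⊃-weaken φ ψ = ⊢-tautology (x₁ ‵⇒ x₀ ‵⇒ x₁) refl (φ ∷ ψ ∷ [])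

[p,q≔_,_] : Formula → Formula → (n P : ℕ) → Formula
[p,q≔ φ , ψ ] zero zero       = φ
[p,q≔ φ , ψ ] zero (suc zero) = ψ
[p,q≔ φ , ψ ] _    _          = ⊤'

K-E-instance : ∀ φ ψ → QCKL⁻ (E' (φ ⊃ ψ) ⊃ (E' φ ⊃ E' ψ))
K-E-instance φ ψ =
  subst₂ (λ φ' ψ' → QCKL⁻ (E' (φ' ⊃ ψ') ⊃ (E' φ' ⊃ E' ψ')))
         (rename-argEnv-[] φ) (rename-argEnv-[] ψ) (us [p,q≔ φ , ψ ] K-E)

C⊑E'^ : ∀ n φ → C' φ ⊑ E'^ n φ
C⊑E'^ n φ =
  subst (λ φ' → C' φ' ⊑ E'^ n φ') (rename-argEnv-[] φ)
    (subst (C' (rename (argEnv [] 0) φ) ⊑_) (substP'-E'^ n 0 [p,q≔ φ , φ ] p)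
      (us [p,q≔ φ , φ ] (C-E n)))

E-mono : ∀ {φ ψ} → φ ⊑ ψ → E' φ ⊑ E' ψ
E-mono {φ} {ψ} φ⊑ψ = mp (K-E-instance φ ψ) (nec-E φ⊑ψ)

E-∧-⊑ : ∀ φ ψ → E' φ ∧' E' ψ ⊑ E' (φ ∧' ψ)
E-∧-⊑ φ ψ =
  by-tautology₂ (x₀ ‵⇒ x₁) (x₁ ‵⇒ x₂ ‵⇒ x₃) (x₀ ‵∧ x₂ ‵⇒ x₃) refl
    (E' φ ∷ E' (ψ ⊃ φ ∧' ψ) ∷ E' ψ ∷ E' (φ ∧' ψ) ∷ [])
    (E-mono (⊢-tautology (x₀ ‵⇒ x₁ ‵⇒ x₀ ‵∧ x₁) refl (φ ∷ ψ ∷ [])))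
    (K-E-instance ψ (φ ∧' ψ))

⊤⊑E⊤ : ⊤' ⊑ E' ⊤'
⊤⊑E⊤ = by-tautology₁ x₀ (x₁ ‵⇒ x₀) refl (E' ⊤' ∷ ⊤' ∷ []) (nec-E ⊢⊤)

-- A variable fresh for γ and ψ is generalised and then discharged by dist∀.
⊑-∀ : ∀ {γ ψ} → (∀ y → γ ⊑ rename (inst y) ψ) → γ ⊑ ∀' ψ
⊑-∀ {γ} {ψ} γ⊑instances =
  mp (ax (dist∀ γ ψ))
     (subst₂ (λ γ' ψ' → QCKL⁻ (∀' (γ' ⊃ ψ'))) γ-shifted ψ-restored (gen y (γ⊑instances y)))
  where
  y : Var
  y = fvBound γ + fvBound ψ

  y-fresh : ∀ {i} k → k ℕ.≤ y → i < k → i ≢ y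
  y-fresh k k≤y i<k = ℕ.<⇒≢ (ℕ.<-≤-trans i<k k≤y)

  γ-shifted : rename (abstr y) γ ≡ rename suc γ
  γ-shifted = rename-cong-below γ λ i i< → abstr-≢ (y-fresh (fvBound γ) (ℕ.m≤m+n _ _) i<)

  ψ-restored : rename (abstr y) (rename (inst y) ψ) ≡ ψ
  ψ-restored =
    trans (rename-∘ ψ (abstr y) (inst y)) (trans (rename-cong-below ψ abstr∘inst) (rename-id ψ))
    where
    abstr∘inst : AgreeBelow (fvBound ψ) (abstr y ∘ inst y) id
    abstr∘inst zero    _   = abstr-self y
    abstr∘inst (suc j) j< = abstr-≢ (y-fresh (fvBound ψ) (ℕ.m≤n+m _ _) (ℕ.<-trans (ℕ.n<1+n j) j<))

-- A set of formulas stands for its join in the completion of the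
-- Lindenbaum algebra: S ≤ˢ T iff everything in S lies below every upper
-- bound of T.

FormulaSet : Set₁
FormulaSet = Formula → Set

UpperBound : FormulaSet → Formula → Set
UpperBound S u = ∀ b → S b → b ⊑ u

infix 4 _≼_ _≤ˢ_ _≃ˢ_

_≼_ : Formula → FormulaSet → Set
a ≼ S = ∀ u → UpperBound S u → a ⊑ u

_≤ˢ_ : FormulaSet → FormulaSet → Set
S ≤ˢ T = ∀ a → S a → a ≼ T

_≃ˢ_ : FormulaSet → FormulaSet → Set
S ≃ˢ T = S ≤ˢ T × T ≤ˢ S

∈⇒≼ : ∀ {S a} → S a → a ≼ S
∈⇒≼ {a = a} a∈S u S≤u = S≤u a a∈S

≼-mono : ∀ {S T a} → S ≤ˢ T → a ≼ S → a ≼ T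
≼-mono S≤T a≼S u T≤u = a≼S u λ b b∈S → S≤T b b∈S u T≤u

⊑-≼-trans : ∀ {S a b} → b ⊑ a → a ≼ S → b ≼ S
⊑-≼-trans b⊑a a≼S u S≤u = ⊑-trans b⊑a (a≼S u S≤u)

≤ˢ-refl : ∀ {S} → S ≤ˢ S
≤ˢ-refl a a∈S = ∈⇒≼ a∈S

≤ˢ-trans : ∀ {S T U} → S ≤ˢ T → T ≤ˢ U → S ≤ˢ U
≤ˢ-trans S≤T T≤U a a∈S = ≼-mono T≤U (S≤T a a∈S)

≃ˢ-refl : ∀ {S} → S ≃ˢ S
≃ˢ-refl = ≤ˢ-refl , ≤ˢ-refl

≃ˢ-sym : ∀ {S T} → S ≃ˢ T → T ≃ˢ S
≃ˢ-sym (S≤T , T≤S) = T≤S , S≤T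

≃ˢ-trans : ∀ {S T U} → S ≃ˢ T → T ≃ˢ U → S ≃ˢ U
≃ˢ-trans (S≤T , T≤S) (T≤U , U≤T) = ≤ˢ-trans S≤T T≤U , ≤ˢ-trans U≤T T≤S

↓_ : Formula → FormulaSet
(↓ φ) c = c ⊑ φ

≼↓⇒⊑ : ∀ {c φ} → c ≼ ↓ φ → c ⊑ φ
≼↓⇒⊑ {φ = φ} c≼↓φ = c≼↓φ φ λ b b⊑φ → b⊑φ

infixr 6 _∪_
infixr 7 _∩_

_∪_ : FormulaSet → FormulaSet → FormulaSet
(S ∪ T) a = S a ⊎ T a

_∩_ : FormulaSet → FormulaSet → FormulaSet
(S ∩ T) a = a ≼ S × a ≼ T

∁ : FormulaSet → FormulaSet
∁ S c = ∀ s → S s → c ⊑ ¬' s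

⊤ˢ ⊥ˢ : FormulaSet
⊤ˢ = ↓ ⊤'
⊥ˢ = ↓ ⊥'

⋀ˢ : {I : Set} → (I → FormulaSet) → FormulaSet
⋀ˢ F a = ∀ j → a ≼ F j

Eˢ : FormulaSet → FormulaSet
Eˢ S c = Σ Formula λ b → b ≼ S × c ⊑ E' b

Cˢ : FormulaSet → FormulaSet
Cˢ S = ⋀ˢ λ (n : Lift 0ℓ ℕ) → iterate Eˢ (lower n) S

≼∩ : ∀ {S T a} → a ≼ S ∩ T → a ≼ S × a ≼ T
≼∩ a≼S∩T = (λ u S≤u → a≼S∩T u λ b b∈ → proj₁ b∈ u S≤u) ,
           (λ u T≤u → a≼S∩T u λ b b∈ → proj₂ b∈ u T≤u)

≼⋀ˢ : ∀ {I : Set} {F : I → FormulaSet} {a} → a ≼ ⋀ˢ F → ∀ j → a ≼ F j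
≼⋀ˢ a≼⋀F j u Fj≤u = a≼⋀F u λ b b∈ → b∈ j u Fj≤u

≤-⊤ˢ : ∀ {S} → S ≤ˢ ⊤ˢ
≤-⊤ˢ a _ = ∈⇒≼ (⊑-⊤ a)

⊥ˢ-≤ : ∀ {S} → ⊥ˢ ≤ˢ S
⊥ˢ-≤ a a⊑⊥ u _ = ⊑-trans a⊑⊥ (⊥-⊑ u)

∪-mono : ∀ {S S' T T'} → S ≤ˢ S' → T ≤ˢ T' → S ∪ T ≤ˢ S' ∪ T'
∪-mono S≤S' T≤T' a (inj₁ a∈S) = ≼-mono (λ b → ∈⇒≼ ∘ inj₁) (S≤S' a a∈S)
∪-mono S≤S' T≤T' a (inj₂ a∈T) = ≼-mono (λ b → ∈⇒≼ ∘ inj₂) (T≤T' a a∈T)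

∩-mono : ∀ {S S' T T'} → S ≤ˢ S' → T ≤ˢ T' → S ∩ T ≤ˢ S' ∩ T'
∩-mono S≤S' T≤T' a (a≼S , a≼T) = ∈⇒≼ (≼-mono S≤S' a≼S , ≼-mono T≤T' a≼T)

∪-cong : ∀ {S S' T T'} → S ≃ˢ S' → T ≃ˢ T' → S ∪ T ≃ˢ S' ∪ T'
∪-cong (S≤ , ≥S) (T≤ , ≥T) = ∪-mono S≤ T≤ , ∪-mono ≥S ≥T

∩-cong : ∀ {S S' T T'} → S ≃ˢ S' → T ≃ˢ T' → S ∩ T ≃ˢ S' ∩ T'
∩-cong (S≤ , ≥S) (T≤ , ≥T) = ∩-mono S≤ T≤ , ∩-mono ≥S ≥T

∪-comm : ∀ S T → S ∪ T ≃ˢ T ∪ S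
∪-comm S T = swap , swap
  where
  swap : ∀ {S T} → S ∪ T ≤ˢ T ∪ S
  swap a (inj₁ a∈S) = ∈⇒≼ (inj₂ a∈S)
  swap a (inj₂ a∈T) = ∈⇒≼ (inj₁ a∈T)

∪-assoc : ∀ S T U → (S ∪ T) ∪ U ≃ˢ S ∪ (T ∪ U)
∪-assoc S T U = to , from
  where
  to : (S ∪ T) ∪ U ≤ˢ S ∪ (T ∪ U)
  to a (inj₁ (inj₁ a∈S)) = ∈⇒≼ (inj₁ a∈S)
  to a (inj₁ (inj₂ a∈T)) = ∈⇒≼ (inj₂ (inj₁ a∈T))
  to a (inj₂ a∈U)        = ∈⇒≼ (inj₂ (inj₂ a∈U))
  from : S ∪ (T ∪ U) ≤ˢ (S ∪ T) ∪ U
  from a (inj₁ a∈S)        = ∈⇒≼ (inj₁ (inj₁ a∈S))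
  from a (inj₂ (inj₁ a∈T)) = ∈⇒≼ (inj₁ (inj₂ a∈T))
  from a (inj₂ (inj₂ a∈U)) = ∈⇒≼ (inj₂ a∈U)

∩-comm : ∀ S T → S ∩ T ≃ˢ T ∩ S
∩-comm S T = (λ a (a≼S , a≼T) → ∈⇒≼ (a≼T , a≼S)) , (λ a (a≼T , a≼S) → ∈⇒≼ (a≼S , a≼T))

∩-assoc : ∀ S T U → (S ∩ T) ∩ U ≃ˢ S ∩ (T ∩ U)
∩-assoc S T U =
  (λ a (a≼S∩T , a≼U) → let a≼S , a≼T = ≼∩ a≼S∩T in ∈⇒≼ (a≼S , ∈⇒≼ (a≼T , a≼U))) ,
  (λ a (a≼S , a≼T∩U) → let a≼T , a≼U = ≼∩ a≼T∩U in ∈⇒≼ (∈⇒≼ (a≼S , a≼T) , a≼U))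

∪-absorbs-∩ : ∀ S T → S ∪ (S ∩ T) ≃ˢ S
∪-absorbs-∩ S T = to , (λ a a∈S → ∈⇒≼ (inj₁ a∈S))
  where
  to : S ∪ (S ∩ T) ≤ˢ S
  to a (inj₁ a∈S)       = ∈⇒≼ a∈S
  to a (inj₂ (a≼S , _)) = a≼S

∩-absorbs-∪ : ∀ S T → S ∩ (S ∪ T) ≃ˢ S
∩-absorbs-∪ S T = (λ a (a≼S , _) → a≼S) , (λ a a∈S → ∈⇒≼ (∈⇒≼ a∈S , ∈⇒≼ (inj₁ a∈S)))

-- Both distributive laws hold because a ⊃ u is an upper bound of a join
-- whenever a ∧ b ⊑ u for each member b.
∩-distribˡ-∪ : ∀ S T U → S ∩ (T ∪ U) ≃ˢ (S ∩ T) ∪ (S ∩ U)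
∩-distribˡ-∪ S T U = to , from
  where
  to : S ∩ (T ∪ U) ≤ˢ (S ∩ T) ∪ (S ∩ U)
  to a (a≼S , a≼T∪U) u bound = ⊃-contract (a≼T∪U (a ⊃ u) a⊃u-bound)
    where
    a∧-≼ : ∀ {V} b → V b → a ∧' b ≼ S × a ∧' b ≼ V
    a∧-≼ b b∈V = ⊑-≼-trans (∧-⊑ˡ a b) a≼S , ⊑-≼-trans (∧-⊑ʳ a b) (∈⇒≼ b∈V)
    a⊃u-bound : UpperBound (T ∪ U) (a ⊃ u)
    a⊃u-bound b (inj₁ b∈T) = curryʳ (bound (a ∧' b) (inj₁ (a∧-≼ b b∈T)))
    a⊃u-bound b (inj₂ b∈U) = curryʳ (bound (a ∧' b) (inj₂ (a∧-≼ b b∈U)))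
  from : (S ∩ T) ∪ (S ∩ U) ≤ˢ S ∩ (T ∪ U)
  from a (inj₁ (a≼S , a≼T)) = ∈⇒≼ (a≼S , ≼-mono (λ b → ∈⇒≼ ∘ inj₁) a≼T)
  from a (inj₂ (a≼S , a≼U)) = ∈⇒≼ (a≼S , ≼-mono (λ b → ∈⇒≼ ∘ inj₂) a≼U)

∪-distribˡ-∩ : ∀ S T U → S ∪ (T ∩ U) ≃ˢ (S ∪ T) ∩ (S ∪ U)
∪-distribˡ-∩ S T U = to , from
  where
  to : S ∪ (T ∩ U) ≤ˢ (S ∪ T) ∩ (S ∪ U)
  to a (inj₁ a∈S)         = ∈⇒≼ (∈⇒≼ (inj₁ a∈S) , ∈⇒≼ (inj₁ a∈S))
  to a (inj₂ (a≼T , a≼U)) = ∈⇒≼ (≼-mono (λ b → ∈⇒≼ ∘ inj₂) a≼T , ≼-mono (λ b → ∈⇒≼ ∘ inj₂) a≼U)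
  from : (S ∪ T) ∩ (S ∪ U) ≤ˢ S ∪ (T ∩ U)
  from a (a≼S∪T , a≼S∪U) u bound = ⊃-contract (a≼S∪U (a ⊃ u) a⊃u-bound)
    where
    c⊃u-bound : ∀ c → U c → UpperBound (S ∪ T) (c ⊃ u)
    c⊃u-bound c c∈U s (inj₁ s∈S) = ⊑-trans (bound s (inj₁ s∈S)) (⊑-⊃-weaken c u)
    c⊃u-bound c c∈U b (inj₂ b∈T) =
      curryˡ (bound (b ∧' c) (inj₂ (⊑-≼-trans (∧-⊑ˡ b c) (∈⇒≼ b∈T) , ⊑-≼-trans (∧-⊑ʳ b c) (∈⇒≼ c∈U))))
    a⊃u-bound : UpperBound (S ∪ U) (a ⊃ u)
    a⊃u-bound s (inj₁ s∈S) = ⊑-trans (bound s (inj₁ s∈S)) (⊑-⊃-weaken a u)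
    a⊃u-bound c (inj₂ c∈U) = ⊃-exchange (a≼S∪T (c ⊃ u) (c⊃u-bound c c∈U))

∁-antitone : ∀ {S T} → T ≤ˢ S → ∁ S ≤ˢ ∁ T
∁-antitone T≤S c c∈∁S =
  ∈⇒≼ λ s s∈T → ⊑¬-sym (T≤S s s∈T (¬' c) λ s' s'∈S → ⊑¬-sym (c∈∁S s' s'∈S))

∁-cong : ∀ {S T} → S ≃ˢ T → ∁ S ≃ˢ ∁ T
∁-cong (S≤T , T≤S) = ∁-antitone T≤S , ∁-antitone S≤T

∪-complementʳ : ∀ S → S ∪ ∁ S ≃ˢ ⊤ˢ
∪-complementʳ S = ≤-⊤ˢ , λ a a⊑⊤ u bound →
  ⊑-trans a⊑⊤ (¬⊑⇒⊤⊑ (bound (¬' u) (inj₂ λ s s∈S → ¬-antitone (bound s (inj₁ s∈S)))))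

∩-complementʳ : ∀ S → S ∩ ∁ S ≃ˢ ⊥ˢ
∩-complementʳ S = to , ⊥ˢ-≤
  where
  to : S ∩ ∁ S ≤ˢ ⊥ˢ
  to a (a≼S , a≼∁S) =
    ∈⇒≼ (⊑¬⇒⊑⊥ (a≼∁S (¬' a) λ b b∈∁S → ⊑¬-sym (a≼S (¬' b) λ s s∈S → ⊑¬-sym (b∈∁S s s∈S))))

Eˢ-mono : ∀ {S T} → S ≤ˢ T → Eˢ S ≤ˢ Eˢ T
Eˢ-mono S≤T c (b , b≼S , c⊑Eb) = ∈⇒≼ (b , ≼-mono S≤T b≼S , c⊑Eb)

Eˢ-cong : ∀ {S T} → S ≃ˢ T → Eˢ S ≃ˢ Eˢ T
Eˢ-cong (S≤T , T≤S) = Eˢ-mono S≤T , Eˢ-mono T≤S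

Eˢ-∩ : ∀ S T → Eˢ (S ∩ T) ≃ˢ Eˢ S ∩ Eˢ T
Eˢ-∩ S T = to , from
  where
  to : Eˢ (S ∩ T) ≤ˢ Eˢ S ∩ Eˢ T
  to c (b , b≼S∩T , c⊑Eb) = let b≼S , b≼T = ≼∩ b≼S∩T in
    ∈⇒≼ (∈⇒≼ (b , b≼S , c⊑Eb) , ∈⇒≼ (b , b≼T , c⊑Eb))
  from : Eˢ S ∩ Eˢ T ≤ˢ Eˢ (S ∩ T)
  from a (a≼ES , a≼ET) u bound = ⊃-contract (a≼ET (a ⊃ u) a⊃u-bound)
    where
    Ec⊃u-bound : ∀ c → c ≼ T → UpperBound (Eˢ S) (E' c ⊃ u)
    Ec⊃u-bound c c≼T d (b , b≼S , d⊑Eb) = ⊑-trans d⊑Eb (curryˡ (⊑-trans (E-∧-⊑ b c)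
      (bound (E' (b ∧' c))
             (b ∧' c , ∈⇒≼ (⊑-≼-trans (∧-⊑ˡ b c) b≼S , ⊑-≼-trans (∧-⊑ʳ b c) c≼T) , ⊑-refl _))))
    a⊃u-bound : UpperBound (Eˢ T) (a ⊃ u)
    a⊃u-bound d (c , c≼T , d⊑Ec) = ⊑-trans d⊑Ec (⊃-exchange (a≼ES (E' c ⊃ u) (Ec⊃u-bound c c≼T)))

Eˢ-⊤ : Eˢ ⊤ˢ ≃ˢ ⊤ˢ
Eˢ-⊤ = ≤-⊤ˢ , λ a a⊑⊤ → ⊑-≼-trans a⊑⊤ (∈⇒≼ (⊤' , ∈⇒≼ (⊑-refl ⊤') , ⊤⊑E⊤))

Eˢ^-cong : ∀ n {S T} → S ≃ˢ T → iterate Eˢ n S ≃ˢ iterate Eˢ n T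
Eˢ^-cong zero    S≃T = S≃T
Eˢ^-cong (suc n) S≃T = Eˢ-cong (Eˢ^-cong n S≃T)

Eˢ^-∩ : ∀ n S T → iterate Eˢ n (S ∩ T) ≃ˢ iterate Eˢ n S ∩ iterate Eˢ n T
Eˢ^-∩ zero    S T = ≃ˢ-refl
Eˢ^-∩ (suc n) S T = ≃ˢ-trans (Eˢ-cong (Eˢ^-∩ n S T)) (Eˢ-∩ _ _)

Eˢ^-⊤ : ∀ n → iterate Eˢ n ⊤ˢ ≃ˢ ⊤ˢ
Eˢ^-⊤ zero    = ≃ˢ-refl
Eˢ^-⊤ (suc n) = ≃ˢ-trans (Eˢ-cong (Eˢ^-⊤ n)) Eˢ-⊤

⋀ˢ-mono : ∀ {I : Set} {F G : I → FormulaSet} → (∀ j → F j ≤ˢ G j) → ⋀ˢ F ≤ˢ ⋀ˢ G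
⋀ˢ-mono F≤G a a∈⋀F = ∈⇒≼ λ j → ≼-mono (F≤G j) (a∈⋀F j)

⋀ˢ-cong : ∀ {I : Set} {F G : I → FormulaSet} → (∀ j → F j ≃ˢ G j) → ⋀ˢ F ≃ˢ ⋀ˢ G
⋀ˢ-cong F≃G = ⋀ˢ-mono (proj₁ ∘ F≃G) , ⋀ˢ-mono (proj₂ ∘ F≃G)

⋀ˢ-∩ : ∀ {I : Set} (F G : I → FormulaSet) → ⋀ˢ (λ j → F j ∩ G j) ≃ˢ ⋀ˢ F ∩ ⋀ˢ G
⋀ˢ-∩ F G = (λ a a∈ → ∈⇒≼ (∈⇒≼ (proj₁ ∘ ≼∩ ∘ a∈) , ∈⇒≼ (proj₂ ∘ ≼∩ ∘ a∈))) ,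
           (λ a (a≼⋀F , a≼⋀G) → ∈⇒≼ λ j → ∈⇒≼ (≼⋀ˢ a≼⋀F j , ≼⋀ˢ a≼⋀G j))

⋀ˢ-⊤ : ∀ {I : Set} (F : I → FormulaSet) → (∀ j → F j ≃ˢ ⊤ˢ) → ⋀ˢ F ≃ˢ ⊤ˢ
⋀ˢ-⊤ F F≃⊤ = ≤-⊤ˢ , λ a a∈⊤ → ∈⇒≼ λ j → ≼-mono (proj₂ (F≃⊤ j)) (∈⇒≼ a∈⊤)

≤ˢ⇒∩≃ˢ : ∀ {S T} → S ≤ˢ T → S ∩ T ≃ˢ S
≤ˢ⇒∩≃ˢ S≤T = (λ a (a≼S , _) → a≼S) , (λ a a∈S → ∈⇒≼ (∈⇒≼ a∈S , S≤T a a∈S))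

∩≃ˢ⇒≤ˢ : ∀ {S T} → S ∩ T ≃ˢ S → S ≤ˢ T
∩≃ˢ⇒≤ˢ S∩T≃S a a∈S = proj₂ (≼∩ (proj₂ S∩T≃S a a∈S))

≃ˢ-setoid : Setoid (lsuc 0ℓ) 0ℓ
≃ˢ-setoid = record
  { Carrier       = FormulaSet
  ; _≈_           = _≃ˢ_
  ; isEquivalence = record { refl = ≃ˢ-refl ; sym = ≃ˢ-sym ; trans = ≃ˢ-trans }
  }

open Consequences ≃ˢ-setoid using (comm∧distrˡ⇒distr; comm∧invʳ⇒inv)

canonicalBooleanAlgebra : BooleanAlgebra (lsuc 0ℓ) 0ℓ
canonicalBooleanAlgebra = record
  { _∨_ = _∪_
  ; _∧_ = _∩_
  ; ¬_  = ∁
  ; ⊤   = ⊤ˢ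
  ; ⊥   = ⊥ˢ
  ; isBooleanAlgebra = record
    { isDistributiveLattice = record
      { isLattice = record
        { isEquivalence = Setoid.isEquivalence ≃ˢ-setoid
        ; ∨-comm        = ∪-comm
        ; ∨-assoc       = ∪-assoc
        ; ∨-cong        = ∪-cong
        ; ∧-comm        = ∩-comm
        ; ∧-assoc       = ∩-assoc
        ; ∧-cong        = ∩-cong
        ; absorptive    = ∪-absorbs-∩ , ∩-absorbs-∪
        }
      ; ∨-distrib-∧ = comm∧distrˡ⇒distr ∩-cong ∪-comm ∪-distribˡ-∩
      ; ∧-distrib-∨ = comm∧distrˡ⇒distr ∪-cong ∩-comm ∩-distribˡ-∪
      }
    ; ∨-complement = comm∧invʳ⇒inv ∪-comm ∪-complementʳ
    ; ∧-complement = comm∧invʳ⇒inv ∩-comm ∩-complementʳ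
    ; ¬-cong       = ∁-cong
    }
  }

canonical : CKL⁻Algebra (lsuc 0ℓ) 0ℓ 0ℓ
canonical = record
  { booleanAlgebra = canonicalBooleanAlgebra
  ; ⋀              = ⋀ˢ
  ; ⋀-lower        = λ F j → ≤ˢ⇒∩≃ˢ λ a a∈⋀F → a∈⋀F j
  ; ⋀-greatest     = λ F S S≤F → ≤ˢ⇒∩≃ˢ λ a a∈S → ∈⇒≼ λ j → ∩≃ˢ⇒≤ˢ (S≤F j) a a∈S
  ; E              = Eˢ
  ; C              = Cˢ
  ; E-cong         = Eˢ-cong
  ; C-cong         = λ S≃T → ⋀ˢ-cong λ n → Eˢ^-cong (lower n) S≃T
  ; E-∧            = Eˢ-∩
  ; C-∧            = λ S T → ≃ˢ-trans (⋀ˢ-cong λ n → Eˢ^-∩ (lower n) S T) (⋀ˢ-∩ _ _)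
  ; E-⊤            = Eˢ-⊤
  ; C-⊤            = ⋀ˢ-⊤ _ λ n → Eˢ^-⊤ (lower n)
  ; C-def          = λ S → ≃ˢ-refl
  }

↓-∧ : ∀ φ ψ → ↓ φ ∩ ↓ ψ ≃ˢ ↓ (φ ∧' ψ)
↓-∧ φ ψ = (λ c (c≼↓φ , c≼↓ψ) → ∈⇒≼ (⊑-∧ (≼↓⇒⊑ c≼↓φ) (≼↓⇒⊑ c≼↓ψ))) ,
          (λ c c⊑φ∧ψ → ∈⇒≼ (∈⇒≼ (⊑-trans c⊑φ∧ψ (∧-⊑ˡ φ ψ)) , ∈⇒≼ (⊑-trans c⊑φ∧ψ (∧-⊑ʳ φ ψ))))

↓-¬ : ∀ φ → ∁ (↓ φ) ≃ˢ ↓ (¬' φ)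
↓-¬ φ = (λ c c∈∁↓φ → ∈⇒≼ (c∈∁↓φ φ (⊑-refl φ))) ,
        (λ c c⊑¬φ → ∈⇒≼ λ s s⊑φ → ⊑-trans c⊑¬φ (¬-antitone s⊑φ))

↓-E : ∀ φ → Eˢ (↓ φ) ≃ˢ ↓ (E' φ)
↓-E φ = (λ c (b , b≼↓φ , c⊑Eb) → ∈⇒≼ (⊑-trans c⊑Eb (E-mono (≼↓⇒⊑ b≼↓φ)))) ,
        (λ c c⊑Eφ → ∈⇒≼ (φ , ∈⇒≼ (⊑-refl φ) , c⊑Eφ))

↓-E'^ : ∀ n φ → iterate Eˢ n (↓ φ) ≃ˢ ↓ (E'^ n φ)
↓-E'^ zero    φ = ≃ˢ-refl
↓-E'^ (suc n) φ = ≃ˢ-trans (Eˢ-cong (↓-E'^ n φ)) (↓-E _)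

-- The ω-rule says exactly that ↓ preserves the meet defining C.
↓-C : ∀ φ → ⋀ˢ (λ (n : Lift 0ℓ ℕ) → ↓ (E'^ (lower n) φ)) ≃ˢ ↓ (C' φ)
↓-C φ = (λ c c∈⋀ → ∈⇒≼ (ω-rule λ n → ≼↓⇒⊑ (c∈⋀ (lift n)))) ,
        (λ c c⊑Cφ → ∈⇒≼ λ n → ∈⇒≼ (⊑-trans c⊑Cφ (C⊑E'^ (lower n) φ)))

↓-∀ : ∀ ψ → ⋀ˢ (λ (y : Var) → ↓ (rename (inst y) ψ)) ≃ˢ ↓ (∀' ψ)
↓-∀ ψ = (λ c c∈⋀ → ∈⇒≼ (⊑-∀ λ y → ≼↓⇒⊑ (c∈⋀ y))) ,
        (λ c c⊑∀ψ → ∈⇒≼ λ y → ∈⇒≼ (⊑-trans c⊑∀ψ (ax (inst∀ ψ y))))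

canonicalInterpretation : (n P : ℕ) → Vec Var n → FormulaSet
canonicalInterpretation n P ys = ↓ atom n P ys

truth-lemma : ∀ φ 𝒜 → ⟦ canonical ⟧ φ canonicalInterpretation 𝒜 ≃ˢ ↓ rename 𝒜 φ
truth-lemma (atom n P ys) 𝒜 = ≃ˢ-refl
truth-lemma ⊤'       𝒜 = ≃ˢ-refl
truth-lemma ⊥'       𝒜 = ≃ˢ-refl
truth-lemma (φ ∧' ψ) 𝒜 = ≃ˢ-trans (∩-cong (truth-lemma φ 𝒜) (truth-lemma ψ 𝒜)) (↓-∧ _ _)
truth-lemma (¬' φ)   𝒜 = ≃ˢ-trans (∁-cong (truth-lemma φ 𝒜)) (↓-¬ _)
truth-lemma (∀' φ)   𝒜 =
  ≃ˢ-trans (⋀ˢ-cong λ d → ≃ˢ-trans (truth-lemma φ (extend canonical d 𝒜)) (≡⇒≃ˢ (instance-of d)))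
           (↓-∀ (rename (liftR 𝒜) φ))
  where
  ≡⇒≃ˢ : ∀ {φ ψ} → φ ≡ ψ → ↓ φ ≃ˢ ↓ ψ
  ≡⇒≃ˢ refl = ≃ˢ-refl
  extend≗inst∘liftR : ∀ d i → extend canonical d 𝒜 i ≡ inst d (liftR 𝒜 i)
  extend≗inst∘liftR d zero    = refl
  extend≗inst∘liftR d (suc i) = refl
  instance-of : ∀ d → rename (extend canonical d 𝒜) φ ≡ rename (inst d) (rename (liftR 𝒜) φ)
  instance-of d = trans (rename-cong φ (extend≗inst∘liftR d)) (sym (rename-∘ φ (inst d) (liftR 𝒜)))
truth-lemma (E' φ)   𝒜 = ≃ˢ-trans (Eˢ-cong (truth-lemma φ 𝒜)) (↓-E _)
truth-lemma (C' φ)   𝒜 =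
  ≃ˢ-trans (⋀ˢ-cong λ n → ≃ˢ-trans (Eˢ^-cong (lower n) (truth-lemma φ 𝒜)) (↓-E'^ (lower n) _))
           (↓-C _)

completeness : ∀ {φ} → Valid φ → QCKL⁻ φ
completeness {φ} valid = ⊤⊑⇒⊢ (subst (⊤' ⊑_) (rename-id φ) (≼↓⇒⊑ ⊤≼↓φ))
  where
  ⊤≼⟦φ⟧ : ⊤' ≼ ⟦ canonical ⟧ φ canonicalInterpretation id
  ⊤≼⟦φ⟧ = proj₂ (valid canonical Var 0 canonicalInterpretation id) ⊤' (⊑-refl ⊤')
  ⊤≼↓φ : ⊤' ≼ ↓ rename id φ
  ⊤≼↓φ = ≼-mono (proj₁ (truth-lemma φ id)) ⊤≼⟦φ⟧

letters : Formula → List Formula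
letters ⊤'       = []
letters ⊥'       = []
letters (φ ∧' ψ) = letters φ ++ letters ψ
letters (¬' φ)   = letters φ
letters φ        = φ ∷ []

infix 8 _[_≔_]
_[_≔_] : (Formula → Bool) → Formula → Bool → Formula → Bool
(v [ ℓ ≔ b ]) m with ℓ ≟ m
... | yes _ = b
... | no _  = v m

module BooleanAlgebraProperties {c ℓ} (B : BooleanAlgebra c ℓ) where
  open BooleanAlgebra B
    renaming (refl to ≈-refl; sym to ≈-sym; trans to ≈-trans; reflexive to ≈-reflexive)
  open BooleanAlgebraₚ B
    using (∧-identityʳ; ∧-identityˡ; ∧-zeroʳ; ∧-zeroˡ; ∨-identityˡ; ∨-identityʳ;
           ¬⊥≈⊤; ¬⊤≈⊥; ¬-involutive; deMorgan₁)
  open Latticeₚ lattice using (∧-idem; ∨-∧-orderTheoreticLattice)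
  private module Order = OrderTheoreticLattice ∨-∧-orderTheoreticLattice
  open SetoidReasoning setoid

  -- the order of CKL⁻Algebra, the converse of the library's x ≈ x ∧ y
  infix 4 _≤_
  _≤_ : Carrier → Carrier → Set ℓ
  x ≤ y = x ∧ y ≈ x

  ≈⇒≤ : ∀ {x y} → x ≈ y → x ≤ y
  ≈⇒≤ x≈y = ≈-sym (Order.reflexive x≈y)

  ≤-refl : ∀ {x} → x ≤ x
  ≤-refl = ≈⇒≤ ≈-refl

  ≤-trans : ∀ {x y z} → x ≤ y → y ≤ z → x ≤ z
  ≤-trans x≤y y≤z = ≈-sym (Order.trans (≈-sym x≤y) (≈-sym y≤z))

  ≤-antisym : ∀ {x y} → x ≤ y → y ≤ x → x ≈ y
  ≤-antisym x≤y y≤x = Order.antisym (≈-sym x≤y) (≈-sym y≤x)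

  ∨-least : ∀ {x y z} → x ≤ z → y ≤ z → x ∨ y ≤ z
  ∨-least x≤z y≤z = ≈-sym (Order.∨-least (≈-sym x≤z) (≈-sym y≤z))

  ⊤≤⇒≈⊤ : ∀ {x} → ⊤ ≤ x → x ≈ ⊤
  ⊤≤⇒≈⊤ {x} ⊤≤x = ≈-trans (≈-sym (∧-identityˡ x)) ⊤≤x

  ≈⊤⇒⊤≤ : ∀ {x} → x ≈ ⊤ → ⊤ ≤ x
  ≈⊤⇒⊤≤ {x} x≈⊤ = ≈-trans (∧-identityˡ x) x≈⊤

  split : ∀ x y → x ≈ (x ∧ y) ∨ (x ∧ ¬ y)
  split x y = begin
    x                   ≈⟨ ∧-identityʳ x ⟨
    x ∧ ⊤               ≈⟨ ∧-congˡ (∨-complementʳ y) ⟨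
    x ∧ (y ∨ ¬ y)       ≈⟨ ∧-distribˡ-∨ x y (¬ y) ⟩
    (x ∧ y) ∨ (x ∧ ¬ y) ∎

  ≤⇒∧¬≈⊥ : ∀ {x y} → x ≤ y → x ∧ ¬ y ≈ ⊥
  ≤⇒∧¬≈⊥ {x} {y} x≤y = begin
    x ∧ ¬ y       ≈⟨ ∧-congʳ x≤y ⟨
    (x ∧ y) ∧ ¬ y ≈⟨ ∧-assoc x y (¬ y) ⟩
    x ∧ (y ∧ ¬ y) ≈⟨ ∧-congˡ (∧-complementʳ y) ⟩
    x ∧ ⊥         ≈⟨ ∧-zeroʳ x ⟩
    ⊥             ∎

  ∧¬≈⊥⇒≤ : ∀ {x y} → x ∧ ¬ y ≈ ⊥ → x ≤ y
  ∧¬≈⊥⇒≤ {x} {y} x∧¬y≈⊥ = ≈-sym (begin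
    x                   ≈⟨ split x y ⟩
    (x ∧ y) ∨ (x ∧ ¬ y) ≈⟨ ∨-congˡ x∧¬y≈⊥ ⟩
    (x ∧ y) ∨ ⊥         ≈⟨ ∨-identityʳ _ ⟩
    x ∧ y               ∎)

  infixr 5 _⇒_
  _⇒_ : Carrier → Carrier → Carrier
  x ⇒ y = ¬ (x ∧ ¬ y)

  ⇒≈⊤⇒≤ : ∀ {x y} → x ⇒ y ≈ ⊤ → x ≤ y
  ⇒≈⊤⇒≤ x⇒y≈⊤ = ∧¬≈⊥⇒≤ (≈-trans (≈-sym (¬-involutive _)) (≈-trans (¬-cong x⇒y≈⊤) ¬⊤≈⊥))

  ≤⇒⇒≈⊤ : ∀ {x y} → x ≤ y → x ⇒ y ≈ ⊤
  ≤⇒⇒≈⊤ x≤y = ≈-trans (¬-cong (≤⇒∧¬≈⊥ x≤y)) ¬⊥≈⊤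

  curry : ∀ {x y z} → x ∧ y ≤ z → x ≤ y ⇒ z
  curry {x} {y} {z} x∧y≤z = ∧¬≈⊥⇒≤ (begin
    x ∧ ¬ ¬ (y ∧ ¬ z) ≈⟨ ∧-congˡ (¬-involutive _) ⟩
    x ∧ (y ∧ ¬ z)     ≈⟨ ∧-assoc x y (¬ z) ⟨
    (x ∧ y) ∧ ¬ z     ≈⟨ ≤⇒∧¬≈⊥ x∧y≤z ⟩
    ⊥                 ∎)

  uncurry : ∀ {x y z} → x ≤ y ⇒ z → x ∧ y ≤ z
  uncurry {x} {y} {z} x≤y⇒z = ∧¬≈⊥⇒≤ (begin
    (x ∧ y) ∧ ¬ z     ≈⟨ ∧-assoc x y (¬ z) ⟩
    x ∧ (y ∧ ¬ z)     ≈⟨ ∧-congˡ (¬-involutive _) ⟨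
    x ∧ ¬ ¬ (y ∧ ¬ z) ≈⟨ ≤⇒∧¬≈⊥ x≤y⇒z ⟩
    ⊥                 ∎)

  module _ (f : Carrier → Carrier) (f-cong : ∀ {x y} → x ≈ y → f x ≈ f y)
           (f-∧ : ∀ x y → f (x ∧ y) ≈ f x ∧ f y) where

    ∧-preserving⇒monotone : ∀ {x y} → x ≤ y → f x ≤ f y
    ∧-preserving⇒monotone {x} {y} x≤y = ≈-trans (≈-sym (f-∧ x y)) (f-cong x≤y)

    ∧-preserving⇒K : ∀ x y → f (x ⇒ y) ≤ f x ⇒ f y
    ∧-preserving⇒K x y =
      curry (≤-trans (≈⇒≤ (≈-sym (f-∧ _ _))) (∧-preserving⇒monotone (uncurry ≤-refl)))

  infix 4 _≈[_]_
  _≈[_]_ : Carrier → Carrier → Carrier → Set ℓ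
  x ≈[ a ] y = a ∧ x ≈ a ∧ y

  ≈[]-∧ : ∀ {a x x' y y'} → x ≈[ a ] x' → y ≈[ a ] y' → x ∧ y ≈[ a ] x' ∧ y'
  ≈[]-∧ {a} {x} {x'} {y} {y'} x≈x' y≈y' = begin
    a ∧ (x ∧ y)   ≈⟨ ∧-assoc a x y ⟨
    (a ∧ x) ∧ y   ≈⟨ ∧-congʳ x≈x' ⟩
    (a ∧ x') ∧ y  ≈⟨ ∧-congʳ (∧-comm a x') ⟩
    (x' ∧ a) ∧ y  ≈⟨ ∧-assoc x' a y ⟩
    x' ∧ (a ∧ y)  ≈⟨ ∧-congˡ y≈y' ⟩
    x' ∧ (a ∧ y') ≈⟨ ∧-assoc x' a y' ⟨
    (x' ∧ a) ∧ y' ≈⟨ ∧-congʳ (∧-comm x' a) ⟩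
    (a ∧ x') ∧ y' ≈⟨ ∧-assoc a x' y' ⟩
    a ∧ (x' ∧ y') ∎

  ∧¬-absorb : ∀ a x → a ∧ ¬ (a ∧ x) ≈ a ∧ ¬ x
  ∧¬-absorb a x = begin
    a ∧ ¬ (a ∧ x)         ≈⟨ ∧-congˡ (deMorgan₁ a x) ⟩
    a ∧ (¬ a ∨ ¬ x)       ≈⟨ ∧-distribˡ-∨ _ _ _ ⟩
    (a ∧ ¬ a) ∨ (a ∧ ¬ x) ≈⟨ ∨-congʳ (∧-complementʳ a) ⟩
    ⊥ ∨ (a ∧ ¬ x)         ≈⟨ ∨-identityˡ _ ⟩
    a ∧ ¬ x               ∎

  ≈[]-¬ : ∀ {a x x'} → x ≈[ a ] x' → ¬ x ≈[ a ] ¬ x'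
  ≈[]-¬ {a} {x} {x'} x≈x' =
    ≈-trans (≈-sym (∧¬-absorb a x)) (≈-trans (∧-congˡ (¬-cong x≈x')) (∧¬-absorb a x'))

  ≈[]-restrict : ∀ {a x y} b → x ≈[ a ] y → x ≈[ a ∧ b ] y
  ≈[]-restrict {a} {x} {y} b x≈y = begin
    (a ∧ b) ∧ x ≈⟨ ∧-congʳ (∧-comm a b) ⟩
    (b ∧ a) ∧ x ≈⟨ ∧-assoc b a x ⟩
    b ∧ (a ∧ x) ≈⟨ ∧-congˡ x≈y ⟩
    b ∧ (a ∧ y) ≈⟨ ∧-assoc b a y ⟨
    (b ∧ a) ∧ y ≈⟨ ∧-congʳ (∧-comm b a) ⟩
    (a ∧ b) ∧ y ∎

  ≈[∧]-⊤ : ∀ a x → x ≈[ a ∧ x ] ⊤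
  ≈[∧]-⊤ a x = begin
    (a ∧ x) ∧ x ≈⟨ ∧-assoc a x x ⟩
    a ∧ (x ∧ x) ≈⟨ ∧-congˡ (∧-idem x) ⟩
    a ∧ x       ≈⟨ ∧-identityʳ _ ⟨
    (a ∧ x) ∧ ⊤ ∎

  ≈[∧¬]-⊥ : ∀ a x → x ≈[ a ∧ ¬ x ] ⊥
  ≈[∧¬]-⊥ a x = begin
    (a ∧ ¬ x) ∧ x ≈⟨ ∧-assoc a (¬ x) x ⟩
    a ∧ (¬ x ∧ x) ≈⟨ ∧-congˡ (∧-complementˡ x) ⟩
    a ∧ ⊥         ≈⟨ ∧-zeroʳ a ⟩
    ⊥             ≈⟨ ∧-zeroʳ _ ⟨
    (a ∧ ¬ x) ∧ ⊥ ∎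

  propValue : (Formula → Carrier) → Formula → Carrier
  propValue g ⊤'       = ⊤
  propValue g ⊥'       = ⊥
  propValue g (φ ∧' ψ) = propValue g φ ∧ propValue g ψ
  propValue g (¬' φ)   = ¬ propValue g φ
  propValue g φ        = g φ

  ⌜_⌝ : Bool → Carrier
  ⌜ true ⌝  = ⊤
  ⌜ false ⌝ = ⊥

  ⌜⌝-∧ : ∀ b b' → ⌜ b ⌝ ∧ ⌜ b' ⌝ ≈ ⌜ b ∧ᵇ b' ⌝
  ⌜⌝-∧ true  b' = ∧-identityˡ _
  ⌜⌝-∧ false b' = ∧-zeroˡ _

  ⌜⌝-¬ : ∀ b → ¬ ⌜ b ⌝ ≈ ⌜ not b ⌝
  ⌜⌝-¬ true  = ¬⊤≈⊥
  ⌜⌝-¬ false = ¬⊥≈⊤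

  propValue-⌜⌝ : ∀ v φ → propValue (⌜_⌝ ∘ v) φ ≈ ⌜ evalB v φ ⌝
  propValue-⌜⌝ v ⊤'       = ≈-refl
  propValue-⌜⌝ v ⊥'       = ≈-refl
  propValue-⌜⌝ v (φ ∧' ψ) =
    ≈-trans (∧-cong (propValue-⌜⌝ v φ) (propValue-⌜⌝ v ψ)) (⌜⌝-∧ (evalB v φ) (evalB v ψ))
  propValue-⌜⌝ v (¬' φ)   = ≈-trans (¬-cong (propValue-⌜⌝ v φ)) (⌜⌝-¬ (evalB v φ))
  propValue-⌜⌝ v (atom _ _ _) = ≈-refl
  propValue-⌜⌝ v (∀' _)       = ≈-refl
  propValue-⌜⌝ v (E' _)       = ≈-refl
  propValue-⌜⌝ v (C' _)       = ≈-refl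

  propValue-cong-letters : ∀ φ {a g g'} → (∀ m → m ∈ letters φ → g m ≈[ a ] g' m) →
                           propValue g φ ≈[ a ] propValue g' φ
  propValue-cong-letters ⊤'       agree = ≈-refl
  propValue-cong-letters ⊥'       agree = ≈-refl
  propValue-cong-letters (φ ∧' ψ) agree =
    ≈[]-∧ (propValue-cong-letters φ λ m m∈ → agree m (∈-++⁺ˡ m∈))
          (propValue-cong-letters ψ λ m m∈ → agree m (∈-++⁺ʳ (letters φ) m∈))
  propValue-cong-letters (¬' φ)   agree = ≈[]-¬ (propValue-cong-letters φ agree)
  propValue-cong-letters (atom _ _ _) agree = agree _ (here refl)
  propValue-cong-letters (∀' _)       agree = agree _ (here refl)
  propValue-cong-letters (E' _)       agree = agree _ (here refl)
  propValue-cong-letters (C' _)       agree = agree _ (here refl)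

  -- Split ⊤ along each letter ℓ into g ℓ and ¬ g ℓ; below each of the
  -- resulting pieces the letters take Boolean values, where φ is true.
  tautology-⊤ : ∀ φ g → PropTautology φ → propValue g φ ≈ ⊤
  tautology-⊤ φ g tautology = ⊤≤⇒≈⊤ (below-pieces (letters φ) ⊤ (λ _ → true) λ m m∈ m∉ → ⊥-elim (m∉ m∈))
    where
    Pinned : List Formula → Carrier → (Formula → Bool) → Set _
    Pinned L a v = ∀ m → m ∈ letters φ → m ∉ L → g m ≈[ a ] ⌜ v m ⌝

    pin : ∀ {L a v x} ℓ′ b → g ℓ′ ≈[ a ∧ x ] ⌜ b ⌝ →
          Pinned (ℓ′ ∷ L) a v → Pinned L (a ∧ x) (v [ ℓ′ ≔ b ])
    pin {x = x} ℓ′ b pinnedℓ′ pinned m m∈ m∉ with ℓ′ ≟ m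
    ... | yes refl = pinnedℓ′
    ... | no ℓ′≢m  =
      ≈[]-restrict x (pinned m m∈ λ { (here m≡ℓ′) → ℓ′≢m (sym m≡ℓ′) ; (there m∈L) → m∉ m∈L })

    below-pieces : ∀ L a v → Pinned L a v → a ≤ propValue g φ
    below-pieces [] a v pinned = begin
      a ∧ propValue g φ              ≈⟨ propValue-cong-letters φ (λ m m∈ → pinned m m∈ λ ()) ⟩
      a ∧ propValue (⌜_⌝ ∘ v) φ      ≈⟨ ∧-congˡ (propValue-⌜⌝ v φ) ⟩
      a ∧ ⌜ evalB v φ ⌝              ≈⟨ ∧-congˡ (≈-reflexive (cong ⌜_⌝ (tautology v))) ⟩
      a ∧ ⊤                          ≈⟨ ∧-identityʳ a ⟩
      a                              ∎
    below-pieces (ℓ′ ∷ L) a v pinned = ≤-trans (≈⇒≤ (split a (g ℓ′))) (∨-least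
      (below-pieces L (a ∧ g ℓ′)   (v [ ℓ′ ≔ true ])  (pin ℓ′ true  (≈[∧]-⊤ a (g ℓ′)) pinned))
      (below-pieces L (a ∧ ¬ g ℓ′) (v [ ℓ′ ≔ false ]) (pin ℓ′ false (≈[∧¬]-⊥ a (g ℓ′)) pinned)))

module Soundness {c ℓ i} (𝔸 : CKL⁻Algebra c ℓ i) where
  open CKL⁻Algebra 𝔸
    renaming (refl to ≈-refl; sym to ≈-sym; trans to ≈-trans; reflexive to ≈-reflexive)
  open BooleanAlgebraProperties booleanAlgebra

  Interpretation : Set i → Set (c ⊔ˡ i)
  Interpretation D = (n P : ℕ) → Vec D n → Carrier

  ⋀-cong : ∀ {I : Set i} {f g : I → Carrier} → (∀ j → f j ≈ g j) → ⋀ f ≈ ⋀ g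
  ⋀-cong {f = f} {g} f≈g =
    ≤-antisym (⋀-greatest g (⋀ f) λ j → ≤-trans (⋀-lower f j) (≈⇒≤ (f≈g j)))
              (⋀-greatest f (⋀ g) λ j → ≤-trans (⋀-lower g j) (≈⇒≤ (≈-sym (f≈g j))))

  ⋀-≈⊤ : ∀ {I : Set i} (f : I → Carrier) → (∀ j → f j ≈ ⊤) → ⋀ f ≈ ⊤
  ⋀-≈⊤ f f≈⊤ = ⊤≤⇒≈⊤ (⋀-greatest f ⊤ λ j → ≈⊤⇒⊤≤ (f≈⊤ j))

  module _ {D : Set i} where

    ⟦⟧-cong-assignment : ∀ φ (𝒥 : Interpretation D) {𝒜 𝒜'} → (∀ k → 𝒜 k ≡ 𝒜' k) →
                         ⟦ 𝔸 ⟧ φ 𝒥 𝒜 ≈ ⟦ 𝔸 ⟧ φ 𝒥 𝒜'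
    ⟦⟧-cong-assignment (atom n P ys) 𝒥 𝒜≗𝒜' = ≈-reflexive (cong (𝒥 n P) (Vec.map-cong 𝒜≗𝒜' ys))
    ⟦⟧-cong-assignment ⊤'       𝒥 𝒜≗𝒜' = ≈-refl
    ⟦⟧-cong-assignment ⊥'       𝒥 𝒜≗𝒜' = ≈-refl
    ⟦⟧-cong-assignment (φ ∧' ψ) 𝒥 𝒜≗𝒜' =
      ∧-cong (⟦⟧-cong-assignment φ 𝒥 𝒜≗𝒜') (⟦⟧-cong-assignment ψ 𝒥 𝒜≗𝒜')
    ⟦⟧-cong-assignment (¬' φ)   𝒥 𝒜≗𝒜' = ¬-cong (⟦⟧-cong-assignment φ 𝒥 𝒜≗𝒜')
    ⟦⟧-cong-assignment (∀' φ)   𝒥 𝒜≗𝒜' = ⋀-cong λ d → ⟦⟧-cong-assignment φ 𝒥 λ where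
      zero    → refl
      (suc k) → 𝒜≗𝒜' k
    ⟦⟧-cong-assignment (E' φ)   𝒥 𝒜≗𝒜' = E-cong (⟦⟧-cong-assignment φ 𝒥 𝒜≗𝒜')
    ⟦⟧-cong-assignment (C' φ)   𝒥 𝒜≗𝒜' = C-cong (⟦⟧-cong-assignment φ 𝒥 𝒜≗𝒜')

    ⟦⟧-rename : ∀ φ ρ (𝒥 : Interpretation D) 𝒜 → ⟦ 𝔸 ⟧ (rename ρ φ) 𝒥 𝒜 ≈ ⟦ 𝔸 ⟧ φ 𝒥 (𝒜 ∘ ρ)
    ⟦⟧-rename (atom n P ys) ρ 𝒥 𝒜 = ≈-reflexive (cong (𝒥 n P) (sym (Vec.map-∘ 𝒜 ρ ys)))
    ⟦⟧-rename ⊤'       ρ 𝒥 𝒜 = ≈-refl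
    ⟦⟧-rename ⊥'       ρ 𝒥 𝒜 = ≈-refl
    ⟦⟧-rename (φ ∧' ψ) ρ 𝒥 𝒜 = ∧-cong (⟦⟧-rename φ ρ 𝒥 𝒜) (⟦⟧-rename ψ ρ 𝒥 𝒜)
    ⟦⟧-rename (¬' φ)   ρ 𝒥 𝒜 = ¬-cong (⟦⟧-rename φ ρ 𝒥 𝒜)
    ⟦⟧-rename (∀' φ)   ρ 𝒥 𝒜 = ⋀-cong λ d →
      ≈-trans (⟦⟧-rename φ (liftR ρ) 𝒥 _) (⟦⟧-cong-assignment φ 𝒥 λ { zero → refl ; (suc k) → refl })
    ⟦⟧-rename (E' φ)   ρ 𝒥 𝒜 = E-cong (⟦⟧-rename φ ρ 𝒥 𝒜)
    ⟦⟧-rename (C' φ)   ρ 𝒥 𝒜 = C-cong (⟦⟧-rename φ ρ 𝒥 𝒜)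

    ⟦⟧-E'^ : ∀ n φ (𝒥 : Interpretation D) 𝒜 → ⟦ 𝔸 ⟧ (E'^ n φ) 𝒥 𝒜 ≡ iterate E n (⟦ 𝔸 ⟧ φ 𝒥 𝒜)
    ⟦⟧-E'^ zero    φ 𝒥 𝒜 = refl
    ⟦⟧-E'^ (suc n) φ 𝒥 𝒜 = cong E (⟦⟧-E'^ n φ 𝒥 𝒜)

    ⟦⟧-propValue : ∀ φ (𝒥 : Interpretation D) 𝒜 → ⟦ 𝔸 ⟧ φ 𝒥 𝒜 ≡ propValue (λ m → ⟦ 𝔸 ⟧ m 𝒥 𝒜) φ
    ⟦⟧-propValue (atom _ _ _) 𝒥 𝒜 = refl
    ⟦⟧-propValue ⊤'       𝒥 𝒜 = refl
    ⟦⟧-propValue ⊥'       𝒥 𝒜 = refl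
    ⟦⟧-propValue (φ ∧' ψ) 𝒥 𝒜 = cong₂ _∧_ (⟦⟧-propValue φ 𝒥 𝒜) (⟦⟧-propValue ψ 𝒥 𝒜)
    ⟦⟧-propValue (¬' φ)   𝒥 𝒜 = cong ¬_ (⟦⟧-propValue φ 𝒥 𝒜)
    ⟦⟧-propValue (∀' _)   𝒥 𝒜 = refl
    ⟦⟧-propValue (E' _)   𝒥 𝒜 = refl
    ⟦⟧-propValue (C' _)   𝒥 𝒜 = refl

    argAssignment : ∀ {n} → Vec D n → (ℕ → D) → ℕ → D
    argAssignment {n} ds 𝒜 j with j <? n
    ... | yes j<n = lookup ds (fromℕ< j<n)
    ... | no _    = 𝒜 (j ∸ n)

    argEnv-assignment : ∀ {n} (ys : Vec Var n) k (𝒜 𝒜₀ : ℕ → D) → (∀ j → 𝒜 (j + k) ≡ 𝒜₀ j) →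
                        ∀ j → 𝒜 (argEnv ys k j) ≡ argAssignment (map 𝒜 ys) 𝒜₀ j
    argEnv-assignment {n} ys k 𝒜 𝒜₀ shifted j with j <? n
    ... | yes j<n = sym (Vec.lookup-map (fromℕ< j<n) 𝒜 ys)
    ... | no _    = shifted (j ∸ n)

    -- 𝒜₀ is 𝒜 with the k variables bound since the substitution started removed
    ⟦⟧-substP' : ∀ σ (𝒥 : Interpretation D) 𝒜₀ φ k 𝒜 → (∀ j → 𝒜 (j + k) ≡ 𝒜₀ j) →
                 ⟦ 𝔸 ⟧ (substP' k σ φ) 𝒥 𝒜 ≈
                 ⟦ 𝔸 ⟧ φ (λ n P ds → ⟦ 𝔸 ⟧ (σ n P) 𝒥 (argAssignment ds 𝒜₀)) 𝒜
    ⟦⟧-substP' σ 𝒥 𝒜₀ (atom n P ys) k 𝒜 shifted =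
      ≈-trans (⟦⟧-rename (σ n P) (argEnv ys k) 𝒥 𝒜)
              (⟦⟧-cong-assignment (σ n P) 𝒥 (argEnv-assignment ys k 𝒜 𝒜₀ shifted))
    ⟦⟧-substP' σ 𝒥 𝒜₀ ⊤'       k 𝒜 shifted = ≈-refl
    ⟦⟧-substP' σ 𝒥 𝒜₀ ⊥'       k 𝒜 shifted = ≈-refl
    ⟦⟧-substP' σ 𝒥 𝒜₀ (φ ∧' ψ) k 𝒜 shifted =
      ∧-cong (⟦⟧-substP' σ 𝒥 𝒜₀ φ k 𝒜 shifted) (⟦⟧-substP' σ 𝒥 𝒜₀ ψ k 𝒜 shifted)
    ⟦⟧-substP' σ 𝒥 𝒜₀ (¬' φ)   k 𝒜 shifted = ¬-cong (⟦⟧-substP' σ 𝒥 𝒜₀ φ k 𝒜 shifted)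
    ⟦⟧-substP' σ 𝒥 𝒜₀ (∀' φ)   k 𝒜 shifted = ⋀-cong λ d →
      ⟦⟧-substP' σ 𝒥 𝒜₀ φ (suc k) (extend 𝔸 d 𝒜) λ j →
        trans (cong (extend 𝔸 d 𝒜) (ℕ.+-suc j k)) (shifted j)
    ⟦⟧-substP' σ 𝒥 𝒜₀ (E' φ)   k 𝒜 shifted = E-cong (⟦⟧-substP' σ 𝒥 𝒜₀ φ k 𝒜 shifted)
    ⟦⟧-substP' σ 𝒥 𝒜₀ (C' φ)   k 𝒜 shifted = C-cong (⟦⟧-substP' σ 𝒥 𝒜₀ φ k 𝒜 shifted)

  soundness : ∀ {φ} → QCKL⁻ φ → ValidIn 𝔸 φ
  soundness {φ} (ax (taut tautology)) D _ 𝒥 𝒜 =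
    ≈-trans (≈-reflexive (⟦⟧-propValue φ 𝒥 𝒜)) (tautology-⊤ φ _ tautology)
  soundness (ax (inst∀ φ y)) D _ 𝒥 𝒜 = ≤⇒⇒≈⊤ (≤-trans (⋀-lower _ (𝒜 y)) (≈⇒≤ (≈-sym
    (≈-trans (⟦⟧-rename φ (inst y) 𝒥 𝒜) (⟦⟧-cong-assignment φ 𝒥 λ { zero → refl ; (suc k) → refl })))))
  soundness (ax (dist∀ φ ψ)) D _ 𝒥 𝒜 = ≤⇒⇒≈⊤ (curry (⋀-greatest _ _ λ d → uncurry (≤-trans (⋀-lower _ d)
    (≈⇒≤ (¬-cong (∧-congʳ (⟦⟧-rename φ suc 𝒥 (extend 𝔸 d 𝒜))))))))
  soundness K-E D _ 𝒥 𝒜 = ≤⇒⇒≈⊤ (∧-preserving⇒K E E-cong E-∧ _ _)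
  soundness K-C D _ 𝒥 𝒜 = ≤⇒⇒≈⊤ (∧-preserving⇒K C C-cong C-∧ _ _)
  soundness (C-E n) D _ 𝒥 𝒜 = ≤⇒⇒≈⊤ (≤-trans (≈⇒≤ (C-def _))
    (≤-trans (⋀-lower _ (lift n)) (≈⇒≤ (≈-reflexive (sym (⟦⟧-E'^ n p 𝒥 𝒜))))))
  soundness (mp ⊢φ⊃ψ ⊢φ) D d₀ 𝒥 𝒜 =
    ⊤≤⇒≈⊤ (≤-trans (≈⊤⇒⊤≤ (soundness ⊢φ D d₀ 𝒥 𝒜)) (⇒≈⊤⇒≤ (soundness ⊢φ⊃ψ D d₀ 𝒥 𝒜)))
  soundness (us {φ} σ ⊢φ) D d₀ 𝒥 𝒜 =
    ≈-trans (⟦⟧-substP' σ 𝒥 𝒜 φ 0 𝒜 λ j → cong 𝒜 (ℕ.+-identityʳ j)) (soundness ⊢φ D d₀ _ 𝒜)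
  soundness (nec-E ⊢φ) D d₀ 𝒥 𝒜 = ≈-trans (E-cong (soundness ⊢φ D d₀ 𝒥 𝒜)) E-⊤
  soundness (nec-C ⊢φ) D d₀ 𝒥 𝒜 = ≈-trans (C-cong (soundness ⊢φ D d₀ 𝒥 𝒜)) C-⊤
  soundness (gen {φ} x ⊢φ) D d₀ 𝒥 𝒜 = ⋀-≈⊤ _ λ d →
    ≈-trans (⟦⟧-rename φ (abstr x) 𝒥 (extend 𝔸 d 𝒜)) (soundness ⊢φ D d₀ 𝒥 (extend 𝔸 d 𝒜 ∘ abstr x))
  soundness (ω-rule {φ = φ} ⊢γ⊃E^φ) D d₀ 𝒥 𝒜 = ≤⇒⇒≈⊤ (≤-trans
    (⋀-greatest _ _ λ n → ≤-trans (⇒≈⊤⇒≤ (soundness (⊢γ⊃E^φ (lower n)) D d₀ 𝒥 𝒜))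
                                  (≈⇒≤ (≈-reflexive (⟦⟧-E'^ (lower n) φ 𝒥 𝒜))))
    (≈⇒≤ (≈-sym (C-def _))))

corollary7p5 : (φ : Formula) → SoundAndComplete φ
corollary7p5 φ = record
  { soundness    = λ ⊢φ 𝔸 → Soundness.soundness 𝔸 ⊢φ
  ; completeness = completeness
  }
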